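{- Let $q\ge 0$ and let $G$ be a Dehn-Sommerville $q$-sphere. Then for every integer $k$ with $0\le k\le q$ and $k+q$ even, the Dehn-Sommerville valuation satisfies $X_{k,q}(G)=\sum_{j=0}^{q}X_{k,q}(j)\,f_j(G)=0$.
   Context: A finite abstract simplicial complex $G$ is a finite set of non-empty finite sets closed under taking non-empty subsets; $f_j(G)$ is the number of $x\in G$ with $|x|=j+1$. For $x\in G$, $\omega(x)=(-1)^{|x|-1}$ and $\chi(A)=\sum_{x\in A}\omega(x)$. The star of $x$ is $U(x)=\{y\in G: x\subset y\}$, $\overline{U(x)}=\{z\in G: z\subset y\text{ for some }y\in U(x)\}$, and the unit sphere is $S(x)=\overline{U(x)}\setminus U(x)$. The empty complex is the Dehn-Sommerville $(-1)$-sphere; for $q\ge 0$ a non-empty complex is a Dehn-Sommerville $q$-manifold if every unit sphere is a Dehn-Sommerville $(q-1)$-sphere, and a Dehn-Sommerville $q$-sphere is a Dehn-Sommerville $q$-manifold with $\chi=1+(-1)^q$. The Dehn-Sommerville vector $X_{k,q}\in\mathbb{Z}^{q+1}$ (indices $j=0,\dots,q$) is $X_{k,q}=\sum_{j=k}^{q}(-1)^{j+q}\binom{j+1}{k+1}e_j-e_k$, where $e_0,\dots,e_q$ are the standard basis vectors; i.e. $X_{k,q}(j)=0$ for $j<k$, $X_{k,q}(k)=(-1)^{k+q}-1$, and $X_{k,q}(j)=(-1)^{j+q}\binom{j+1}{k+1}$ for $j>k$. -}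

module Defs where

open import Data.Nat using (ℕ; zero; suc; _+_; _<ᵇ_; _≡ᵇ_)
open import Data.Nat.Combinatorics using (_C_)
open import Data.Integer as ℤ using (ℤ; +_; -_; 0ℤ; 1ℤ)
open import Data.Bool using (Bool; true; false; if_then_else_)
open import Data.Fin.Subset using (Subset; _⊆_; Nonempty; ∣_∣)
open import Data.Fin.Subset.Properties using (_⊆?_)
open import Data.List using (List; []; _∷_; filter; length; map; foldr; upTo)
open import Data.List.Membership.Propositional using (_∈_)
open import Data.List.Relation.Unary.Any using (Any; any?)
open import Data.List.Relation.Unary.Unique.Propositional using (Unique)
open import Data.Product using (_×_)
open import Relation.Binary.PropositionalEquality using (_≡_; _≢_)
open import Relation.Nullary using (¬_; ¬?)

-- A finite abstract simplicial complex on the vertex set Fin n: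
-- a duplicate-free list of non-empty subsets of Fin n, closed under
-- taking non-empty subsets.  (Every finite complex is isomorphic to
-- one whose vertices lie in some Fin n.)
IsComplex : {n : ℕ} → List (Subset n) → Set
IsComplex {n} G =
  Unique G
  × (∀ {x} → x ∈ G → Nonempty x)
  × (∀ {x y : Subset n} → x ∈ G → y ⊆ x → Nonempty y → y ∈ G)

isEven : ℕ → Bool
isEven zero = true
isEven (suc zero) = false
isEven (suc (suc m)) = isEven m

sgn : ℕ → ℤ
sgn m = if isEven m then 1ℤ else ℤ.- 1ℤ

sumℤ : List ℤ → ℤ
sumℤ = foldr ℤ._+_ 0ℤ

fvec : {n : ℕ} → List (Subset n) → ℕ → ℕ
fvec G j = length (filter (λ x → ∣ x ∣ Data.Nat.≟ suc j) G)

ω : {n : ℕ} → Subset n → ℤ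
ω x = ℤ.- sgn ∣ x ∣

χ : {n : ℕ} → List (Subset n) → ℤ
χ A = sumℤ (map ω A)

star : {n : ℕ} → List (Subset n) → Subset n → List (Subset n)
star G x = filter (λ y → x ⊆? y) G

starClosure : {n : ℕ} → List (Subset n) → Subset n → List (Subset n)
starClosure G x = filter (λ z → any? (λ y → z ⊆? y) (star G x)) G

unitSphere : {n : ℕ} → List (Subset n) → Subset n → List (Subset n)
unitSphere G x = filter (λ z → ¬? (x ⊆? z)) (starClosure G x)

-- DSSphere' d G : G is a Dehn-Sommerville (d-1)-sphere
-- DSManifold q G : G is a Dehn-Sommerville q-manifold
DSSphere' : {n : ℕ} → ℕ → List (Subset n) → Set
DSManifold : {n : ℕ} → ℕ → List (Subset n) → Set

DSManifold q G = (G ≢ []) × (∀ {x} → x ∈ G → DSSphere' q (unitSphere G x))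

DSSphere' zero G = G ≡ []
DSSphere' (suc q) G = DSManifold q G × (χ G ≡ 1ℤ ℤ.+ sgn q)

DSSphere : {n : ℕ} → ℕ → List (Subset n) → Set
DSSphere q G = DSSphere' (suc q) G

Xcoef : ℕ → ℕ → ℕ → ℤ
Xcoef k q j =
  if j <ᵇ k then 0ℤ
  else if j ≡ᵇ k then sgn (k + q) ℤ.- 1ℤ
  else sgn (j + q) ℤ.* (+ (suc j C suc k))

DSValuation : {n : ℕ} → ℕ → ℕ → List (Subset n) → ℤ
DSValuation k q G = sumℤ (map (λ j → Xcoef k q j ℤ.* (+ fvec G j)) (upTo (suc q)))

-- The closed star of a face x consists of the faces z with z ∪ x ∈ G. Together with the empty set it is a
-- cone with apex x, whose alternating sum vanishes because toggling a vertex of x reverses the sign; hence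
-- χ(closed star) = 1. The closed star is the disjoint union of U(x) and the unit sphere S(x), a
-- Dehn–Sommerville (q−1)-sphere, so χ(U(x)) = 1 − χ(S(x)) = (−1)^q.
-- Counting the pairs x ⊆ y of faces with |x| = k + 1, weighted by ω(y), in two ways gives
--   (−1)^q f_k = Σ_{|x|=k+1} χ(U(x)) = Σ_y ω(y) C(|y|, k+1) = Σ_{j ≤ q} (−1)^j C(j+1, k+1) f_j,
-- the last sum stopping at q because, by induction through unit spheres, faces have at most q + 1 vertices.
-- Multiplying by (−1)^q gives X_{k,q}(G) = 0.

module Submission where

open import Data.Bool as Bool using (Bool; true; false; T; _∧_; _∨_)
open import Data.Bool.Properties using (∧-zeroʳ; T-∧)
open import Function.Bundles using (Equivalence)
open import Data.Fin using (zero; suc)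
open import Data.Fin.Subset using (Subset; inside; outside; _⊆_; _∪_; ⊥; ∣_∣; Nonempty)
open import Data.Fin.Subset.Properties
  using (_⊆?_; ⊆-refl; ∉⊥; ∣⊥∣≡0; ∪-identityˡ; p⊆p∪q; q⊆p∪q; x∈p∪q⁻; p⊆q⇒∣p∣≤∣q∣; nonempty?; Empty-unique)
open import Data.Integer as ℤ using (ℤ; +_; 0ℤ; 1ℤ; -1ℤ; _+_; _*_; -_; _-_)
import Data.Integer.Properties as ℤ
open import Data.Integer.Tactic.RingSolver using (solve-∀)
open import Data.List using (List; []; _∷_; _++_; map; filter; length; upTo)
open import Data.List.Properties using (map-∘; map-upTo)
open import Data.List.Membership.Propositional using (_∈_; find; lose)
open import Data.List.Membership.Propositional.Properties using (∈-filter⁺; ∈-filter⁻)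
import Data.List.Membership.DecPropositional as DecMembership
import Data.List.Relation.Unary.All as All
open import Data.List.Relation.Unary.Any using (Any; here; there; any?)
open import Data.List.Relation.Unary.AllPairs using (_∷_)
open import Data.List.Relation.Unary.Unique.Propositional using (Unique)
open import Data.Nat as ℕ using (ℕ; zero; suc; _≤_; _<_; z≤n; s≤s; _≡ᵇ_; _<ᵇ_)
import Data.Nat.Properties as ℕ
open import Data.Nat.Combinatorics using (_C_; nCn≡1; k>n⇒nCk≡0; nCk+nC[k+1]≡[n+1]C[k+1])
open import Data.Product using (_×_; _,_; proj₁; proj₂)
open import Data.Sum using ([_,_])
open import Data.Vec.Base using ([]; _∷_; here; there)
open import Data.Vec.Properties using (≡-dec)
open import Relation.Binary.Definitions using (DecidableEquality; tri<; tri≈; tri>)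
open import Relation.Binary.PropositionalEquality hiding ([_])
open import Relation.Nullary using (Dec; yes; no; does; ¬_; ¬?; contradiction)
open import Relation.Nullary.Decidable using (dec-true; dec-false)
open import Relation.Unary using (Decidable)
open import Function using (_∘_)

open import Defs

open ≡-Reasoning

-- Sums, indicators and signs

T-does⁻ : {P : Set} (p? : Dec P) → T (does p?) → P
T-does⁻ (yes p) _ = p

T-does⁺ : {P : Set} (p? : Dec P) → P → T (does p?)
T-does⁺ (yes _) _ = _
T-does⁺ (no ¬p) p = contradiction p ¬p

does-≡ : {P Q : Set} (p? : Dec P) (q? : Dec Q) → (P → Q) → (Q → P) → does p? ≡ does q?
does-≡ (yes _)  (yes _)  _  _    = refl
does-≡ (no _)   (no _)   _  _    = refl
does-≡ (yes p)  (no ¬q)  to _    = contradiction (to p) ¬q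
does-≡ (no ¬p)  (yes q)  _  from = contradiction (from q) ¬p

ind : Bool → ℤ → ℤ
ind true  v = v
ind false _ = 0ℤ

∑ : {A : Set} → List A → (A → ℤ) → ℤ
∑ xs f = sumℤ (map f xs)

syntax ∑ xs (λ x → e) = ∑[ x ← xs ] e

private
  variable
    A B : Set

∑-cong : {f g : A → ℤ} (xs : List A) → (∀ {x} → x ∈ xs → f x ≡ g x) → ∑ xs f ≡ ∑ xs g
∑-cong []       _   = refl
∑-cong (x ∷ xs) f≗g = cong₂ _+_ (f≗g (here refl)) (∑-cong xs (λ x∈xs → f≗g (there x∈xs)))

∑-zero : (xs : List A) → ∑ xs (λ _ → 0ℤ) ≡ 0ℤ
∑-zero []       = refl
∑-zero (x ∷ xs) = trans (ℤ.+-identityˡ _) (∑-zero xs)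

∑-+ : (xs : List A) (f g : A → ℤ) → ∑[ x ← xs ] (f x + g x) ≡ ∑ xs f + ∑ xs g
∑-+ []       f g = refl
∑-+ (x ∷ xs) f g = begin
  f x + g x + ∑[ y ← xs ] (f y + g y) ≡⟨ cong (_+_ (f x + g x)) (∑-+ xs f g) ⟩
  f x + g x + (∑ xs f + ∑ xs g)       ≡⟨ interchange (f x) (g x) (∑ xs f) (∑ xs g) ⟩
  f x + ∑ xs f + (g x + ∑ xs g)       ∎
  where
  interchange : ∀ a b c d → a + b + (c + d) ≡ a + c + (b + d)
  interchange = solve-∀

∑-*ˡ : (c : ℤ) (xs : List A) (f : A → ℤ) → ∑[ x ← xs ] (c * f x) ≡ c * ∑ xs f
∑-*ˡ c []       f = sym (ℤ.*-zeroʳ c)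
∑-*ˡ c (x ∷ xs) f = trans (cong (_+_ (c * f x)) (∑-*ˡ c xs f)) (sym (ℤ.*-distribˡ-+ c (f x) (∑ xs f)))

∑-const : (c : ℤ) (xs : List A) → ∑ xs (λ _ → c) ≡ c * + length xs
∑-const c []       = sym (ℤ.*-zeroʳ c)
∑-const c (x ∷ xs) = trans (cong (_+_ c) (∑-const c xs)) (*-suc c (+ length xs))
  where
  *-suc : ∀ a m → a + a * m ≡ a * (1ℤ + m)
  *-suc = solve-∀

∑-++ : (xs ys : List A) (f : A → ℤ) → ∑ (xs ++ ys) f ≡ ∑ xs f + ∑ ys f
∑-++ []       ys f = sym (ℤ.+-identityˡ (∑ ys f))
∑-++ (x ∷ xs) ys f = trans (cong (_+_ (f x)) (∑-++ xs ys f)) (sym (ℤ.+-assoc (f x) (∑ xs f) (∑ ys f)))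

∑-map : (g : A → B) (xs : List A) (f : B → ℤ) → ∑ (map g xs) f ≡ ∑[ x ← xs ] f (g x)
∑-map g xs f = cong sumℤ (sym (map-∘ xs))

∑-filter : {P : A → Set} (P? : Decidable P) (xs : List A) (f : A → ℤ) →
           ∑ (filter P? xs) f ≡ ∑[ x ← xs ] ind (does (P? x)) (f x)
∑-filter P? []       f = refl
∑-filter P? (x ∷ xs) f with does (P? x)
... | true  = cong (_+_ (f x)) (∑-filter P? xs f)
... | false = trans (∑-filter P? xs f) (sym (ℤ.+-identityˡ _))

∑-swap : (xs : List A) (ys : List B) (h : A → B → ℤ) →
         ∑[ x ← xs ] ∑[ y ← ys ] h x y ≡ ∑[ y ← ys ] ∑[ x ← xs ] h x y
∑-swap []       ys h = sym (∑-zero ys)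
∑-swap (x ∷ xs) ys h = begin
  ∑ ys (h x) + ∑[ x′ ← xs ] ∑[ y ← ys ] h x′ y ≡⟨ cong (_+_ (∑ ys (h x))) (∑-swap xs ys h) ⟩
  ∑ ys (h x) + ∑[ y ← ys ] ∑[ x′ ← xs ] h x′ y ≡⟨ sym (∑-+ ys (h x) (λ y → ∑[ x′ ← xs ] h x′ y)) ⟩
  ∑[ y ← ys ] (h x y + ∑[ x′ ← xs ] h x′ y)    ∎

ind-∑ : (b : Bool) (xs : List A) (f : A → ℤ) → ind b (∑ xs f) ≡ ∑[ x ← xs ] ind b (f x)
ind-∑ true  xs f = refl
ind-∑ false xs f = sym (∑-zero xs)

ind-∧ : ∀ a b v → ind a (ind b v) ≡ ind (a ∧ b) v
ind-∧ true  b v = refl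
ind-∧ false b v = refl

ind-≡-*ind : ∀ b v → ind b v ≡ v * ind b 1ℤ
ind-≡-*ind true  v = sym (ℤ.*-identityʳ v)
ind-≡-*ind false v = sym (ℤ.*-zeroʳ v)

ind-absorb : ∀ a b v → (T b → T a) → ind a (ind b v) ≡ ind b v
ind-absorb true  b     v _   = refl
ind-absorb false false v _   = refl
ind-absorb false true  v b⇒a = contradiction (b⇒a _) λ ()

ind-split : ∀ a b v → (T b → T a) → ind a v ≡ ind b v + ind a (ind (Bool.not b) v)
ind-split a     false v _   = sym (ℤ.+-identityˡ (ind a v))
ind-split true  true  v _   = sym (ℤ.+-identityʳ v)
ind-split false true  v b⇒a = contradiction (b⇒a _) λ ()

ind-∨ : ∀ a b v → ¬ (T a × T b) → ind (a ∨ b) v ≡ ind a v + ind b v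
ind-∨ true  true  v disjoint = contradiction (_ , _) disjoint
ind-∨ true  false v _        = sym (ℤ.+-identityʳ v)
ind-∨ false b     v _        = sym (ℤ.+-identityˡ (ind b v))

sgn-suc : ∀ m → sgn (suc m) ≡ - sgn m
sgn-suc zero          = refl
sgn-suc (suc zero)    = refl
sgn-suc (suc (suc m)) = sgn-suc m

-sgn-suc : ∀ m → - sgn (suc m) ≡ sgn m
-sgn-suc m = trans (cong -_ (sgn-suc m)) (ℤ.neg-involutive (sgn m))

sgn-+ : ∀ a b → sgn (a ℕ.+ b) ≡ sgn a * sgn b
sgn-+ zero    b = sym (ℤ.*-identityˡ (sgn b))
sgn-+ (suc a) b = begin
  sgn (suc (a ℕ.+ b))  ≡⟨ sgn-suc (a ℕ.+ b) ⟩
  - sgn (a ℕ.+ b)      ≡⟨ cong -_ (sgn-+ a b) ⟩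
  - (sgn a * sgn b)    ≡⟨ ℤ.neg-distribˡ-* (sgn a) (sgn b) ⟩
  - sgn a * sgn b      ≡⟨ cong (_* sgn b) (sym (sgn-suc a)) ⟩
  sgn (suc a) * sgn b  ∎

sgn*sgn : ∀ m → sgn m * sgn m ≡ 1ℤ
sgn*sgn zero          = refl
sgn*sgn (suc zero)    = refl
sgn*sgn (suc (suc m)) = sgn*sgn m

-- Sums over all subsets of Fin n

subsets : (n : ℕ) → List (Subset n)
subsets zero    = [] ∷ []
subsets (suc n) = map (inside ∷_) (subsets n) ++ map (outside ∷_) (subsets n)

∑-subsets-suc : ∀ n (f : Subset (suc n) → ℤ) →
                ∑ (subsets (suc n)) f ≡ ∑[ s ← subsets n ] f (inside ∷ s) + ∑[ s ← subsets n ] f (outside ∷ s)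
∑-subsets-suc n f = trans (∑-++ (map (inside ∷_) (subsets n)) _ f)
                          (cong₂ _+_ (∑-map (inside ∷_) (subsets n) f) (∑-map (outside ∷_) (subsets n) f))

infix 4 _≟ₛ_ _∈?_

_≟ₛ_ : ∀ {n} → DecidableEquality (Subset n)
_≟ₛ_ = ≡-dec Bool._≟_

_∈?_ : ∀ {n} (s : Subset n) (G : List (Subset n)) → Dec (s ∈ G)
s ∈? G = DecMembership._∈?_ _≟ₛ_ s G

∑-subsets-point : ∀ n (t : Subset n) (h : Subset n → ℤ) →
                  ∑[ s ← subsets n ] ind (does (s ≟ₛ t)) (h s) ≡ h t
∑-subsets-point zero    []            h = ℤ.+-identityʳ (h [])
∑-subsets-point (suc n) (inside ∷ t)  h = begin
  ∑[ s ← subsets (suc n) ] ind (does (s ≟ₛ (inside ∷ t))) (h s)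
    ≡⟨ ∑-subsets-suc n _ ⟩
  ∑[ s ← subsets n ] ind (does (s ≟ₛ t)) (h (inside ∷ s)) + ∑ (subsets n) (λ _ → 0ℤ)
    ≡⟨ cong₂ _+_ (∑-subsets-point n t (λ s → h (inside ∷ s))) (∑-zero (subsets n)) ⟩
  h (inside ∷ t) + 0ℤ
    ≡⟨ ℤ.+-identityʳ _ ⟩
  h (inside ∷ t) ∎
∑-subsets-point (suc n) (outside ∷ t) h = begin
  ∑[ s ← subsets (suc n) ] ind (does (s ≟ₛ (outside ∷ t))) (h s)
    ≡⟨ ∑-subsets-suc n _ ⟩
  ∑ (subsets n) (λ _ → 0ℤ) + ∑[ s ← subsets n ] ind (does (s ≟ₛ t)) (h (outside ∷ s))
    ≡⟨ cong₂ _+_ (∑-zero (subsets n)) (∑-subsets-point n t (λ s → h (outside ∷ s))) ⟩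
  0ℤ + h (outside ∷ t)
    ≡⟨ ℤ.+-identityˡ _ ⟩
  h (outside ∷ t) ∎

∑-unique≡∑-subsets : ∀ {n} (G : List (Subset n)) → Unique G → (g : Subset n → ℤ) →
                     ∑ G g ≡ ∑[ s ← subsets n ] ind (does (s ∈? G)) (g s)
∑-unique≡∑-subsets {n} []      _             g = sym (∑-zero (subsets n))
∑-unique≡∑-subsets {n} (y ∷ G) (y∉G ∷ uniq) g = begin
  g y + ∑ G g
    ≡⟨ cong₂ _+_ (sym (∑-subsets-point n y g)) (∑-unique≡∑-subsets G uniq g) ⟩
  ∑[ s ← subsets n ] ind (does (s ≟ₛ y)) (g s) + ∑[ s ← subsets n ] ind (does (s ∈? G)) (g s)
    ≡⟨ sym (∑-+ (subsets n) _ _) ⟩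
  ∑[ s ← subsets n ] (ind (does (s ≟ₛ y)) (g s) + ind (does (s ∈? G)) (g s))
    ≡⟨ ∑-cong (subsets n) (λ {s} _ → sym (ind-∨ (does (s ≟ₛ y)) (does (s ∈? G)) (g s) (not-both s))) ⟩
  ∑[ s ← subsets n ] ind (does (s ∈? (y ∷ G))) (g s)
    ∎
  where
  not-both : ∀ s → ¬ (T (does (s ≟ₛ y)) × T (does (s ∈? G)))
  not-both s (s≡y , s∈G) with T-does⁻ (s ≟ₛ y) s≡y
  ... | refl = All.lookup y∉G (T-does⁻ (s ∈? G) s∈G) refl

∑-alternating-vanishes : ∀ {n} (x : Subset n) → Nonempty x → (F : Subset n → ℤ) →
                         ∑[ s ← subsets n ] (sgn ∣ s ∣ * F (s ∪ x)) ≡ 0ℤ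
∑-alternating-vanishes {suc n} (inside ∷ x) (zero , here) F = begin
  ∑[ s ← subsets (suc n) ] (sgn ∣ s ∣ * F (s ∪ (inside ∷ x)))
    ≡⟨ ∑-subsets-suc n _ ⟩
  ∑[ s ← subsets n ] (sgn (suc ∣ s ∣) * F′ s) + ∑[ s ← subsets n ] (sgn ∣ s ∣ * F′ s)
    ≡⟨ sym (∑-+ (subsets n) _ _) ⟩
  ∑[ s ← subsets n ] (sgn (suc ∣ s ∣) * F′ s + sgn ∣ s ∣ * F′ s)
    ≡⟨ ∑-cong (subsets n) (λ {s} _ → cancel ∣ s ∣ (F′ s)) ⟩
  ∑ (subsets n) (λ _ → 0ℤ)
    ≡⟨ ∑-zero (subsets n) ⟩
  0ℤ ∎
  where
  F′ : Subset n → ℤ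
  F′ s = F (inside ∷ (s ∪ x))
  cancel : ∀ m v → sgn (suc m) * v + sgn m * v ≡ 0ℤ
  cancel m v = trans (cong (λ σ → σ * v + sgn m * v) (sgn-suc m)) (-a*v+a*v≡0 (sgn m) v)
    where
    -a*v+a*v≡0 : ∀ a v → - a * v + a * v ≡ 0ℤ
    -a*v+a*v≡0 = solve-∀
∑-alternating-vanishes {suc n} (b ∷ x) (suc i , there i∈x) F = begin
  ∑[ s ← subsets (suc n) ] (sgn ∣ s ∣ * F (s ∪ (b ∷ x)))
    ≡⟨ ∑-subsets-suc n _ ⟩
  ∑[ s ← subsets n ] (sgn (suc ∣ s ∣) * F (inside ∷ (s ∪ x))) + ∑[ s ← subsets n ] (sgn ∣ s ∣ * F (b ∷ (s ∪ x)))
    ≡⟨ cong₂ _+_ (∑-cong (subsets n) (λ {s} _ → flip-sign ∣ s ∣ (F (inside ∷ (s ∪ x))))) refl ⟩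
  ∑[ s ← subsets n ] (-1ℤ * (sgn ∣ s ∣ * F (inside ∷ (s ∪ x)))) + ∑[ s ← subsets n ] (sgn ∣ s ∣ * F (b ∷ (s ∪ x)))
    ≡⟨ cong₂ _+_ (∑-*ˡ -1ℤ (subsets n) _) (∑-alternating-vanishes x (i , i∈x) (λ u → F (b ∷ u))) ⟩
  -1ℤ * ∑[ s ← subsets n ] (sgn ∣ s ∣ * F (inside ∷ (s ∪ x))) + 0ℤ
    ≡⟨ cong (λ t → -1ℤ * t + 0ℤ) (∑-alternating-vanishes x (i , i∈x) (λ u → F (inside ∷ u))) ⟩
  0ℤ ∎
  where
  flip-sign : ∀ m v → sgn (suc m) * v ≡ -1ℤ * (sgn m * v)
  flip-sign m v = trans (cong (_* v) (sgn-suc m)) (-a*v≡-1*[a*v] (sgn m) v)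
    where
    -a*v≡-1*[a*v] : ∀ a v → - a * v ≡ -1ℤ * (a * v)
    -a*v≡-1*[a*v] = solve-∀

∑-subsets-of-size-⊆ : ∀ {n} (y : Subset n) m →
                      ∑[ s ← subsets n ] ind ((∣ s ∣ ≡ᵇ m) ∧ does (s ⊆? y)) 1ℤ ≡ + (∣ y ∣ C m)
∑-subsets-of-size-⊆ []           zero    = refl
∑-subsets-of-size-⊆ []           (suc m) = refl
∑-subsets-of-size-⊆ {suc n} (inside ∷ y) zero = begin
  ∑[ s ← subsets (suc n) ] ind ((∣ s ∣ ≡ᵇ 0) ∧ does (s ⊆? (inside ∷ y))) 1ℤ
    ≡⟨ ∑-subsets-suc n _ ⟩
  ∑ (subsets n) (λ _ → 0ℤ) + ∑[ s ← subsets n ] ind ((∣ s ∣ ≡ᵇ 0) ∧ does (s ⊆? y)) 1ℤ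
    ≡⟨ cong₂ _+_ (∑-zero (subsets n)) (∑-subsets-of-size-⊆ y zero) ⟩
  0ℤ + 1ℤ ∎
∑-subsets-of-size-⊆ {suc n} (inside ∷ y) (suc m) = begin
  ∑[ s ← subsets (suc n) ] ind ((∣ s ∣ ≡ᵇ suc m) ∧ does (s ⊆? (inside ∷ y))) 1ℤ
    ≡⟨ ∑-subsets-suc n _ ⟩
  ∑[ s ← subsets n ] ind ((∣ s ∣ ≡ᵇ m) ∧ does (s ⊆? y)) 1ℤ + ∑[ s ← subsets n ] ind ((∣ s ∣ ≡ᵇ suc m) ∧ does (s ⊆? y)) 1ℤ
    ≡⟨ cong₂ _+_ (∑-subsets-of-size-⊆ y m) (∑-subsets-of-size-⊆ y (suc m)) ⟩
  + (∣ y ∣ C m) + + (∣ y ∣ C suc m)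
    ≡⟨ sym (ℤ.pos-+ (∣ y ∣ C m) (∣ y ∣ C suc m)) ⟩
  + (∣ y ∣ C m ℕ.+ ∣ y ∣ C suc m)
    ≡⟨ cong +_ (nCk+nC[k+1]≡[n+1]C[k+1] ∣ y ∣ m) ⟩
  + (suc ∣ y ∣ C suc m) ∎
∑-subsets-of-size-⊆ {suc n} (outside ∷ y) m = begin
  ∑[ s ← subsets (suc n) ] ind ((∣ s ∣ ≡ᵇ m) ∧ does (s ⊆? (outside ∷ y))) 1ℤ
    ≡⟨ ∑-subsets-suc n _ ⟩
  ∑[ s ← subsets n ] ind ((suc ∣ s ∣ ≡ᵇ m) ∧ false) 1ℤ + ∑[ s ← subsets n ] ind ((∣ s ∣ ≡ᵇ m) ∧ does (s ⊆? y)) 1ℤ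
    ≡⟨ cong₂ _+_ (∑-cong (subsets n) (λ {s} _ → cong (λ b → ind b 1ℤ) (∧-zeroʳ (suc ∣ s ∣ ≡ᵇ m)))) refl ⟩
  ∑ (subsets n) (λ _ → 0ℤ) + ∑[ s ← subsets n ] ind ((∣ s ∣ ≡ᵇ m) ∧ does (s ⊆? y)) 1ℤ
    ≡⟨ cong₂ _+_ (∑-zero (subsets n)) (∑-subsets-of-size-⊆ y m) ⟩
  0ℤ + + (∣ y ∣ C m)
    ≡⟨ ℤ.+-identityˡ _ ⟩
  + (∣ y ∣ C m) ∎

-- Counting faces by size and Dehn–Sommerville spheres

∑-upTo-suc : ∀ N (f : ℕ → ℤ) → ∑ (upTo (suc N)) f ≡ f 0 + ∑[ j ← upTo N ] f (suc j)
∑-upTo-suc N f = cong (_+_ (f 0)) (trans (cong (λ js → ∑ js f) (sym (map-upTo suc N))) (∑-map suc (upTo N) f))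

∑-upTo-point : ∀ N a (h : ℕ → ℤ) → a < N → ∑[ j ← upTo N ] ind (a ≡ᵇ j) (h j) ≡ h a
∑-upTo-point (suc N) zero h _ = begin
  ∑[ j ← upTo (suc N) ] ind (0 ≡ᵇ j) (h j)  ≡⟨ ∑-upTo-suc N (λ j → ind (0 ≡ᵇ j) (h j)) ⟩
  h 0 + ∑ (upTo N) (λ _ → 0ℤ)              ≡⟨ cong (_+_ (h 0)) (∑-zero (upTo N)) ⟩
  h 0 + 0ℤ                                 ≡⟨ ℤ.+-identityʳ (h 0) ⟩
  h 0                                      ∎
∑-upTo-point (suc N) (suc a) h (s≤s a<N) = begin
  ∑[ j ← upTo (suc N) ] ind (suc a ≡ᵇ j) (h j)   ≡⟨ ∑-upTo-suc N (λ j → ind (suc a ≡ᵇ j) (h j)) ⟩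
  0ℤ + ∑[ j ← upTo N ] ind (a ≡ᵇ j) (h (suc j))  ≡⟨ ℤ.+-identityˡ _ ⟩
  ∑[ j ← upTo N ] ind (a ≡ᵇ j) (h (suc j))       ≡⟨ ∑-upTo-point N a (λ j → h (suc j)) a<N ⟩
  h (suc a)                                      ∎

Nonempty⇒∣p∣>0 : ∀ {n} (s : Subset n) → Nonempty s → 0 < ∣ s ∣
Nonempty⇒∣p∣>0 (inside  ∷ s) _                  = s≤s z≤n
Nonempty⇒∣p∣>0 (outside ∷ s) (suc i , there i∈s) = Nonempty⇒∣p∣>0 s (i , i∈s)

∣p∣>0⇒Nonempty : ∀ {n} (s : Subset n) → 0 < ∣ s ∣ → Nonempty s
∣p∣>0⇒Nonempty (inside  ∷ s) _ = zero , here
∣p∣>0⇒Nonempty (outside ∷ s) ∣s∣>0 with ∣p∣>0⇒Nonempty s ∣s∣>0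
... | i , i∈s = suc i , there i∈s

fvec≡∑ : ∀ {n} (G : List (Subset n)) j → + fvec G j ≡ ∑[ y ← G ] ind (∣ y ∣ ≡ᵇ suc j) 1ℤ
fvec≡∑ G j = begin
  + fvec G j                                    ≡⟨ sym (ℤ.*-identityˡ _) ⟩
  1ℤ * + fvec G j                               ≡⟨ sym (∑-const 1ℤ (filter (λ y → ∣ y ∣ ℕ.≟ suc j) G)) ⟩
  ∑ (filter (λ y → ∣ y ∣ ℕ.≟ suc j) G) (λ _ → 1ℤ) ≡⟨ ∑-filter (λ y → ∣ y ∣ ℕ.≟ suc j) G _ ⟩
  ∑[ y ← G ] ind (∣ y ∣ ≡ᵇ suc j) 1ℤ             ∎

∑-by-size : ∀ {n} (G : List (Subset n)) N (h : ℕ → ℤ) → (∀ {y} → y ∈ G → Nonempty y × ∣ y ∣ ≤ N) →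
            ∑[ y ← G ] h ∣ y ∣ ≡ ∑[ j ← upTo N ] (h (suc j) * + fvec G j)
∑-by-size G N h sizes = sym (begin
  ∑[ j ← upTo N ] (h (suc j) * + fvec G j)
    ≡⟨ ∑-cong (upTo N) (λ {j} _ → cong (h (suc j) *_) (fvec≡∑ G j)) ⟩
  ∑[ j ← upTo N ] (h (suc j) * ∑[ y ← G ] ind (∣ y ∣ ≡ᵇ suc j) 1ℤ)
    ≡⟨ ∑-cong (upTo N) (λ {j} _ → sym (trans (∑-cong G (λ {y} _ → ind-≡-*ind (∣ y ∣ ≡ᵇ suc j) (h (suc j))))
                                             (∑-*ˡ (h (suc j)) G _))) ⟩
  ∑[ j ← upTo N ] ∑[ y ← G ] ind (∣ y ∣ ≡ᵇ suc j) (h (suc j))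
    ≡⟨ ∑-swap (upTo N) G _ ⟩
  ∑[ y ← G ] ∑[ j ← upTo N ] ind (∣ y ∣ ≡ᵇ suc j) (h (suc j))
    ≡⟨ ∑-cong G (λ {y} y∈G → point ∣ y ∣ (Nonempty⇒∣p∣>0 y (proj₁ (sizes y∈G))) (proj₂ (sizes y∈G))) ⟩
  ∑[ y ← G ] h ∣ y ∣ ∎)
  where
  point : ∀ m → 0 < m → m ≤ N → ∑[ j ← upTo N ] ind (m ≡ᵇ suc j) (h (suc j)) ≡ h m
  point (suc a) _ a<N = ∑-upTo-point N a (λ j → h (suc j)) a<N

χ-DSSphere' : ∀ d {n} {H : List (Subset n)} → DSSphere' d H → χ H ≡ 1ℤ - sgn d
χ-DSSphere' zero    refl          = refl
χ-DSSphere' (suc d) (_ , χH≡1+σ) = trans χH≡1+σ (cong (_+_ 1ℤ) (sym (-sgn-suc d)))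

∈-unitSphere : ∀ {n} {H : List (Subset n)} {y w : Subset n} →
               y ∈ H → w ∈ H → w ⊆ y → ¬ (y ⊆ w) → w ∈ unitSphere H y
∈-unitSphere {H = H} {y} {w} y∈H w∈H w⊆y y⊈w =
  ∈-filter⁺ (λ z → ¬? (y ⊆? z))
    (∈-filter⁺ (λ z → any? (z ⊆?_) (star H y)) w∈H (lose (∈-filter⁺ (y ⊆?_) y∈H ⊆-refl) w⊆y))
    y⊈w

removeFirst : ∀ {n} → Subset n → Subset n
removeFirst []            = []
removeFirst (inside  ∷ s) = outside ∷ s
removeFirst (outside ∷ s) = outside ∷ removeFirst s

∣removeFirst∣ : ∀ {n} (s : Subset n) → 0 < ∣ s ∣ → suc ∣ removeFirst s ∣ ≡ ∣ s ∣
∣removeFirst∣ (inside  ∷ s) _     = refl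
∣removeFirst∣ (outside ∷ s) ∣s∣>0 = ∣removeFirst∣ s ∣s∣>0

removeFirst-⊆ : ∀ {n} (s : Subset n) → removeFirst s ⊆ s
removeFirst-⊆ (inside  ∷ s) (there i∈s) = there i∈s
removeFirst-⊆ (outside ∷ s) (there i∈s) = there (removeFirst-⊆ s i∈s)

-- If ∣ y ∣ ≥ 2, then y minus one vertex lies in the unit sphere S(y), together with all its faces.
face-size-≤ : ∀ d {n} {H : List (Subset n)} {y : Subset n} → DSSphere' d H → y ∈ H →
              (∀ {z} → z ⊆ y → Nonempty z → z ∈ H) → ∣ y ∣ ≤ d
face-size-≤ zero refl ()
face-size-≤ (suc d) {H = H} {y} ((_ , spheres) , _) y∈H faces-of-y with ∣ y ∣ ℕ.≤? 1
... | yes ∣y∣≤1 = ℕ.≤-trans ∣y∣≤1 (s≤s z≤n)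
... | no  ∣y∣≰1 =
  subst (_≤ suc d) ∣z∣+1≡∣y∣
        (s≤s (face-size-≤ d (spheres y∈H) (faces-of-z ⊆-refl (∣p∣>0⇒Nonempty z ∣z∣>0)) faces-of-z))
  where
  ∣y∣>1 : 1 < ∣ y ∣
  ∣y∣>1 = ℕ.≰⇒> ∣y∣≰1
  z : Subset _
  z = removeFirst y
  ∣z∣+1≡∣y∣ : suc ∣ z ∣ ≡ ∣ y ∣
  ∣z∣+1≡∣y∣ = ∣removeFirst∣ y (ℕ.<-trans (s≤s z≤n) ∣y∣>1)
  ∣z∣>0 : 0 < ∣ z ∣
  ∣z∣>0 = ℕ.s≤s⁻¹ (subst (1 <_) (sym ∣z∣+1≡∣y∣) ∣y∣>1)
  faces-of-z : ∀ {w} → w ⊆ z → Nonempty w → w ∈ unitSphere H y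
  faces-of-z {w} w⊆z w≠∅ = ∈-unitSphere y∈H (faces-of-y w⊆y w≠∅) w⊆y y⊈w
    where
    w⊆y : w ⊆ y
    w⊆y i∈w = removeFirst-⊆ y (w⊆z i∈w)
    y⊈w : ¬ (y ⊆ w)
    y⊈w y⊆w = ℕ.<-irrefl refl (subst (_≤ ∣ z ∣) (sym ∣z∣+1≡∣y∣) (p⊆q⇒∣p∣≤∣q∣ (λ i∈y → w⊆z (y⊆w i∈y))))

module SimplicialComplex {n : ℕ} {G : List (Subset n)} (isComplex : IsComplex G) where

  private
    unique : Unique G
    unique = proj₁ isComplex

    nonempty : ∀ {x} → x ∈ G → Nonempty x
    nonempty = proj₁ (proj₂ isComplex)

    downClosed : ∀ {x y} → x ∈ G → y ⊆ x → Nonempty y → y ∈ G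
    downClosed = proj₂ (proj₂ isComplex)

  in-closedStar? : Subset n → Subset n → Bool
  in-closedStar? x z = does (any? (z ⊆?_) (star G x))

  in-closedStar?≡∪∈? : ∀ {x} → x ∈ G → ∀ z → in-closedStar? x z ≡ does (z ∪ x ∈? G)
  in-closedStar?≡∪∈? {x} x∈G z = does-≡ (any? (z ⊆?_) (star G x)) (z ∪ x ∈? G) to from
    where
    to : Any (z ⊆_) (star G x) → z ∪ x ∈ G
    to z⊆star with find z⊆star
    ... | y , y∈star , z⊆y with ∈-filter⁻ (x ⊆?_) {xs = G} y∈star
    ... | y∈G , x⊆y = downClosed y∈G (λ i∈z∪x → [ z⊆y , x⊆y ] (x∈p∪q⁻ z x i∈z∪x)) z∪x≠∅
      where
      z∪x≠∅ : Nonempty (z ∪ x)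
      z∪x≠∅ = let i , i∈x = nonempty x∈G in i , q⊆p∪q z x i∈x
    from : z ∪ x ∈ G → Any (z ⊆_) (star G x)
    from z∪x∈G = lose (∈-filter⁺ (x ⊆?_) z∪x∈G (q⊆p∪q z x)) (p⊆p∪q x)

  ∑-cone : ∀ {x} → x ∈ G → ∑[ z ← ⊥ ∷ G ] ind (does (z ∪ x ∈? G)) (ω z) ≡ 0ℤ
  ∑-cone {x} x∈G = begin
    ∑[ z ← ⊥ ∷ G ] ind (does (z ∪ x ∈? G)) (ω z)
      ≡⟨ ∑-unique≡∑-subsets (⊥ ∷ G) (⊥∉G ∷ unique) _ ⟩
    ∑[ s ← subsets n ] ind (does (s ∈? (⊥ ∷ G))) (ind (does (s ∪ x ∈? G)) (ω s))
      ≡⟨ ∑-cong (subsets n) (λ {s} _ → ind-absorb _ _ (ω s) (T-does⁺ (s ∈? (⊥ ∷ G)) ∘ ∈⊥∷G s ∘ T-does⁻ (s ∪ x ∈? G))) ⟩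
    ∑[ s ← subsets n ] ind (does (s ∪ x ∈? G)) (ω s)
      ≡⟨ ∑-cong (subsets n) (λ {s} _ → ind-neg (does (s ∪ x ∈? G)) (sgn ∣ s ∣)) ⟩
    ∑[ s ← subsets n ] (-1ℤ * (sgn ∣ s ∣ * ind (does (s ∪ x ∈? G)) 1ℤ))
      ≡⟨ ∑-*ˡ -1ℤ (subsets n) _ ⟩
    -1ℤ * ∑[ s ← subsets n ] (sgn ∣ s ∣ * ind (does (s ∪ x ∈? G)) 1ℤ)
      ≡⟨ cong (-1ℤ *_) (∑-alternating-vanishes x (nonempty x∈G) (λ u → ind (does (u ∈? G)) 1ℤ)) ⟩
    0ℤ ∎
    where
    ⊥∉G : All.All (⊥ ≢_) G
    ⊥∉G = All.tabulate λ y∈G → λ { refl → ∉⊥ (proj₂ (nonempty y∈G)) }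
    ∈⊥∷G : ∀ s → s ∪ x ∈ G → s ∈ ⊥ ∷ G
    ∈⊥∷G s s∪x∈G with nonempty? s
    ... | yes s≠∅ = there (downClosed s∪x∈G (p⊆p∪q x) s≠∅)
    ... | no  s=∅ = here (Empty-unique s=∅)
    ind-neg : ∀ b σ → ind b (- σ) ≡ -1ℤ * (σ * ind b 1ℤ)
    ind-neg b σ = trans (ind-≡-*ind b (- σ)) (-σ*v≡-1*[σ*v] σ (ind b 1ℤ))
      where
      -σ*v≡-1*[σ*v] : ∀ σ v → - σ * v ≡ -1ℤ * (σ * v)
      -σ*v≡-1*[σ*v] = solve-∀

  χ-closedStar : ∀ {x} → x ∈ G → χ (starClosure G x) ≡ 1ℤ
  χ-closedStar {x} x∈G = begin
    χ (starClosure G x)                         ≡⟨ ∑-filter (λ z → any? (z ⊆?_) (star G x)) G ω ⟩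
    ∑[ z ← G ] ind (in-closedStar? x z) (ω z)   ≡⟨ ∑-cong G (λ {z} _ → cong (λ b → ind b (ω z)) (in-closedStar?≡∪∈? x∈G z)) ⟩
    ∑ G cone-term                               ≡⟨ a≡-1+a+1 (∑ G cone-term) ⟩
    -1ℤ + ∑ G cone-term + 1ℤ                    ≡⟨ cong (_+ 1ℤ) cone ⟩
    0ℤ + 1ℤ                                     ∎
    where
    cone-term : Subset n → ℤ
    cone-term z = ind (does (z ∪ x ∈? G)) (ω z)
    apex : cone-term ⊥ ≡ -1ℤ
    apex = cong₂ ind (trans (cong (λ u → does (u ∈? G)) (∪-identityˡ x)) (dec-true (x ∈? G) x∈G))
                     (cong (λ m → - sgn m) (∣⊥∣≡0 n))
    cone : -1ℤ + ∑ G cone-term ≡ 0ℤ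
    cone = trans (cong (_+ ∑ G cone-term) (sym apex)) (∑-cone x∈G)
    a≡-1+a+1 : ∀ a → a ≡ -1ℤ + a + 1ℤ
    a≡-1+a+1 = solve-∀

  χ-closedStar-split : ∀ x → χ (starClosure G x) ≡ χ (star G x) + χ (unitSphere G x)
  χ-closedStar-split x = begin
    χ (starClosure G x)
      ≡⟨ ∑-filter (λ z → any? (z ⊆?_) (star G x)) G ω ⟩
    ∑[ z ← G ] ind (in-closedStar? x z) (ω z)
      ≡⟨ ∑-cong G (λ {z} z∈G → ind-split _ _ (ω z) (T-does⁺ (any? (z ⊆?_) (star G x)) ∘ in-star z∈G ∘ T-does⁻ (x ⊆? z))) ⟩
    ∑[ z ← G ] (ind (does (x ⊆? z)) (ω z) + ind (in-closedStar? x z) (ind (Bool.not (does (x ⊆? z))) (ω z)))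
      ≡⟨ ∑-+ G _ _ ⟩
    ∑[ z ← G ] ind (does (x ⊆? z)) (ω z) + ∑[ z ← G ] ind (in-closedStar? x z) (ind (Bool.not (does (x ⊆? z))) (ω z))
      ≡⟨ sym (cong₂ _+_ (∑-filter (x ⊆?_) G ω)
                        (trans (∑-filter (λ z → ¬? (x ⊆? z)) (starClosure G x) ω)
                               (∑-filter (λ z → any? (z ⊆?_) (star G x)) G _))) ⟩
    χ (star G x) + χ (unitSphere G x) ∎
    where
    in-star : ∀ {z} → z ∈ G → x ⊆ z → Any (z ⊆_) (star G x)
    in-star z∈G x⊆z = lose (∈-filter⁺ (x ⊆?_) z∈G x⊆z) ⊆-refl

  χ-star : ∀ {d x} → x ∈ G → DSSphere' d (unitSphere G x) → χ (star G x) ≡ sgn d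
  χ-star {d} {x} x∈G S[x]-sphere = a+[1-c]≡1⇒a≡c (χ (star G x)) (sgn d) (begin
    χ (star G x) + (1ℤ - sgn d)            ≡⟨ cong (_+_ (χ (star G x))) (sym (χ-DSSphere' d S[x]-sphere)) ⟩
    χ (star G x) + χ (unitSphere G x)      ≡⟨ sym (χ-closedStar-split x) ⟩
    χ (starClosure G x)                    ≡⟨ χ-closedStar x∈G ⟩
    1ℤ                                     ∎)
    where
    a+[1-c]≡1⇒a≡c : ∀ a c → a + (1ℤ - c) ≡ 1ℤ → a ≡ c
    a+[1-c]≡1⇒a≡c a c eq = trans (a≡[a+[1-c]]+[c-1] a c) (trans (cong (_+ (c - 1ℤ)) eq) (1+[c-1]≡c c))
      where
      a≡[a+[1-c]]+[c-1] : ∀ a c → a ≡ (a + (1ℤ - c)) + (c - 1ℤ)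
      a≡[a+[1-c]]+[c-1] = solve-∀
      1+[c-1]≡c : ∀ c → 1ℤ + (c - 1ℤ) ≡ c
      1+[c-1]≡c = solve-∀

  ∑-faces-of-size-⊆ : ∀ {y} → y ∈ G → ∀ m → 0 < m →
                      ∑[ x ← G ] ind ((∣ x ∣ ≡ᵇ m) ∧ does (x ⊆? y)) 1ℤ ≡ + (∣ y ∣ C m)
  ∑-faces-of-size-⊆ {y} y∈G m m>0 = begin
    ∑[ x ← G ] ind ((∣ x ∣ ≡ᵇ m) ∧ does (x ⊆? y)) 1ℤ
      ≡⟨ ∑-unique≡∑-subsets G unique _ ⟩
    ∑[ s ← subsets n ] ind (does (s ∈? G)) (ind ((∣ s ∣ ≡ᵇ m) ∧ does (s ⊆? y)) 1ℤ)
      ≡⟨ ∑-cong (subsets n) (λ {s} _ → ind-absorb _ _ 1ℤ (T-does⁺ (s ∈? G) ∘ face s ∘ Equivalence.to T-∧)) ⟩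
    ∑[ s ← subsets n ] ind ((∣ s ∣ ≡ᵇ m) ∧ does (s ⊆? y)) 1ℤ
      ≡⟨ ∑-subsets-of-size-⊆ y m ⟩
    + (∣ y ∣ C m) ∎
    where
    face : ∀ s → T (∣ s ∣ ≡ᵇ m) × T (does (s ⊆? y)) → s ∈ G
    face s (∣s∣≡m , s⊆y) =
      downClosed y∈G (T-does⁻ (s ⊆? y) s⊆y)
                 (∣p∣>0⇒Nonempty s (subst (0 <_) (sym (ℕ.≡ᵇ⇒≡ ∣ s ∣ m ∣s∣≡m)) m>0))

  ∑-χ-star-of-size : ∀ k → ∑[ x ← filter (λ x → ∣ x ∣ ℕ.≟ suc k) G ] χ (star G x)
                           ≡ ∑[ y ← G ] (ω y * + (∣ y ∣ C suc k))
  ∑-χ-star-of-size k = begin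
    ∑[ x ← filter (λ x → ∣ x ∣ ℕ.≟ suc k) G ] χ (star G x)
      ≡⟨ ∑-filter (λ x → ∣ x ∣ ℕ.≟ suc k) G _ ⟩
    ∑[ x ← G ] ind (∣ x ∣ ≡ᵇ suc k) (χ (star G x))
      ≡⟨ ∑-cong G (λ {x} _ → trans (cong (ind (∣ x ∣ ≡ᵇ suc k)) (∑-filter (x ⊆?_) G ω)) (ind-∑ _ G _)) ⟩
    ∑[ x ← G ] ∑[ y ← G ] ind (∣ x ∣ ≡ᵇ suc k) (ind (does (x ⊆? y)) (ω y))
      ≡⟨ ∑-swap G G _ ⟩
    ∑[ y ← G ] ∑[ x ← G ] ind (∣ x ∣ ≡ᵇ suc k) (ind (does (x ⊆? y)) (ω y))
      ≡⟨ ∑-cong G (λ {y} y∈G → begin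
           ∑[ x ← G ] ind (∣ x ∣ ≡ᵇ suc k) (ind (does (x ⊆? y)) (ω y))
             ≡⟨ ∑-cong G (λ {x} _ → trans (ind-∧ (∣ x ∣ ≡ᵇ suc k) (does (x ⊆? y)) (ω y)) (ind-≡-*ind _ (ω y))) ⟩
           ∑[ x ← G ] (ω y * ind ((∣ x ∣ ≡ᵇ suc k) ∧ does (x ⊆? y)) 1ℤ)
             ≡⟨ ∑-*ˡ (ω y) G _ ⟩
           ω y * ∑[ x ← G ] ind ((∣ x ∣ ≡ᵇ suc k) ∧ does (x ⊆? y)) 1ℤ
             ≡⟨ cong (ω y *_) (∑-faces-of-size-⊆ y∈G (suc k) (s≤s z≤n)) ⟩
           ω y * + (∣ y ∣ C suc k) ∎) ⟩
    ∑[ y ← G ] (ω y * + (∣ y ∣ C suc k)) ∎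

  face-size-≤-dim : ∀ {q y} → DSSphere q G → y ∈ G → ∣ y ∣ ≤ suc q
  face-size-≤-dim {q} sphere y∈G = face-size-≤ (suc q) sphere y∈G (downClosed y∈G)

  dehnSommerville-f : ∀ {q} → DSSphere q G → ∀ k →
                      ∑[ j ← upTo (suc q) ] (sgn j * + (suc j C suc k) * + fvec G j) ≡ sgn q * + fvec G k
  dehnSommerville-f {q} sphere@((_ , spheres) , _) k = begin
    ∑[ j ← upTo (suc q) ] (sgn j * + (suc j C suc k) * + fvec G j)
      ≡⟨ ∑-cong (upTo (suc q)) (λ {j} _ → cong (λ σ → σ * + (suc j C suc k) * + fvec G j) (sym (-sgn-suc j))) ⟩
    ∑[ j ← upTo (suc q) ] (ω-coefficient (suc j) * + fvec G j)
      ≡⟨ sym (∑-by-size G (suc q) ω-coefficient (λ y∈G → nonempty y∈G , face-size-≤-dim sphere y∈G)) ⟩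
    ∑[ y ← G ] (ω y * + (∣ y ∣ C suc k))
      ≡⟨ sym (∑-χ-star-of-size k) ⟩
    ∑[ x ← faces-of-size ] χ (star G x)
      ≡⟨ ∑-cong faces-of-size (λ x∈ → let x∈G = proj₁ (∈-filter⁻ size? {xs = G} x∈) in χ-star x∈G (spheres x∈G)) ⟩
    ∑ faces-of-size (λ _ → sgn q)
      ≡⟨ ∑-const (sgn q) faces-of-size ⟩
    sgn q * + fvec G k ∎
    where
    size? : Decidable (λ (x : Subset n) → ∣ x ∣ ≡ suc k)
    size? x = ∣ x ∣ ℕ.≟ suc k
    faces-of-size : List (Subset n)
    faces-of-size = filter size? G
    ω-coefficient : ℕ → ℤ
    ω-coefficient m = - sgn m * + (m C suc k)

-- The Dehn–Sommerville valuation

<ᵇ-true : ∀ {m n} → m < n → (m <ᵇ n) ≡ true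
<ᵇ-true {m} {n} = dec-true (m ℕ.<? n)

<ᵇ-false : ∀ {m n} → ¬ m < n → (m <ᵇ n) ≡ false
<ᵇ-false {m} {n} = dec-false (m ℕ.<? n)

≡ᵇ-true : ∀ {m} → (m ≡ᵇ m) ≡ true
≡ᵇ-true {m} = dec-true (m ℕ.≟ m) refl

≡ᵇ-false : ∀ {m n} → m ≢ n → (m ≡ᵇ n) ≡ false
≡ᵇ-false {m} {n} = dec-false (m ℕ.≟ n)

Xcoef-split : ∀ k q j v → Xcoef k q j * v ≡ sgn q * (sgn j * + (suc j C suc k) * v) + ind (k ≡ᵇ j) (- v)
Xcoef-split k q j v with ℕ.<-cmp j k
... | tri< j<k j≢k _
  rewrite <ᵇ-true j<k | ≡ᵇ-false (j≢k ∘ sym) | k>n⇒nCk≡0 (s≤s j<k) = below (sgn q) (sgn j) v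
  where
  below : ∀ a b v → 0ℤ * v ≡ a * (b * 0ℤ * v) + 0ℤ
  below = solve-∀
... | tri≈ j≮j refl _
  rewrite <ᵇ-false j≮j | ≡ᵇ-true {j} | nCn≡1 (suc j) | sgn-+ j q = diagonal (sgn j) (sgn q) v
  where
  diagonal : ∀ a b v → (a * b - 1ℤ) * v ≡ b * (a * 1ℤ * v) + - v
  diagonal = solve-∀
... | tri> j≮k j≢k _
  rewrite <ᵇ-false j≮k | ≡ᵇ-false j≢k | ≡ᵇ-false (j≢k ∘ sym) | sgn-+ j q = above (sgn j) (sgn q) (+ (suc j C suc k)) v
  where
  above : ∀ a b c v → a * b * c * v ≡ b * (a * c * v) + 0ℤ
  above = solve-∀

mainTheorem6 : (n : ℕ) (G : List (Subset n)) → IsComplex G →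
    (q : ℕ) → DSSphere q G →
    (k : ℕ) → k ≤ q → isEven (k ℕ.+ q) ≡ true →
    DSValuation k q G ≡ 0ℤ
mainTheorem6 n G isComplex q sphere k k≤q _ = begin
  DSValuation k q G
    ≡⟨ ∑-cong (upTo (suc q)) (λ {j} _ → Xcoef-split k q j (f j)) ⟩
  ∑[ j ← upTo (suc q) ] (sgn q * a j + ind (k ≡ᵇ j) (- f j))
    ≡⟨ ∑-+ (upTo (suc q)) (λ j → sgn q * a j) (λ j → ind (k ≡ᵇ j) (- f j)) ⟩
  ∑[ j ← upTo (suc q) ] (sgn q * a j) + ∑[ j ← upTo (suc q) ] ind (k ≡ᵇ j) (- f j)
    ≡⟨ cong₂ _+_ (∑-*ˡ (sgn q) (upTo (suc q)) a) (∑-upTo-point (suc q) k (λ j → - f j) (s≤s k≤q)) ⟩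
  sgn q * ∑[ j ← upTo (suc q) ] a j + - f k
    ≡⟨ cong (λ t → sgn q * t + - f k) (dehnSommerville-f sphere k) ⟩
  sgn q * (sgn q * f k) + - f k
    ≡⟨ σ*[σ*v]-v≡0 (sgn q) (f k) (sgn*sgn q) ⟩
  0ℤ ∎
  where
  open SimplicialComplex isComplex
  f : ℕ → ℤ
  f j = + fvec G j
  a : ℕ → ℤ
  a j = sgn j * + (suc j C suc k) * f j
  σ*[σ*v]-v≡0 : ∀ σ v → σ * σ ≡ 1ℤ → σ * (σ * v) + - v ≡ 0ℤ
  σ*[σ*v]-v≡0 σ v σ²≡1 = begin
    σ * (σ * v) + - v   ≡⟨ cong (_+ - v) (sym (ℤ.*-assoc σ σ v)) ⟩
    σ * σ * v + - v     ≡⟨ cong (λ t → t * v + - v) σ²≡1 ⟩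
    1ℤ * v + - v        ≡⟨ cong (_+ - v) (ℤ.*-identityˡ v) ⟩
    v + - v             ≡⟨ ℤ.+-inverseʳ v ⟩
    0ℤ                  ∎
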